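{- There exists a data set of tuples in $U^m$ such that, for the algorithm that samples $r$ tuples uniformly at random without replacement and rejects a subset of coordinates $A$ exactly when some pair of sampled tuples is not separated by $A$, rejecting a bad subset $A$ with probability at least $1-e^{ -m}$ requires $r=\Omega\!\left(\frac{m}{\sqrt{\epsilon}}\right)$.
   Context: For a data set $\{x_1,\dots,x_n\}\subseteq U^m$, a subset $A\subseteq[m]$ separates $x_i,x_j$ if they differ in some coordinate of $A$; $A$ is bad if it separates fewer than $(1-\epsilon)\binom{n}{2}$ pairs of tuples. -}

module Defs where

open import Data.Nat using (ℕ; zero; suc; _+_; _^_; _<ᵇ_; _≡ᵇ_; _!)
open import Data.Nat.Combinatorics using (_C_)
open import Data.Bool using (Bool; true; false; _∧_; not; if_then_else_)
open import Data.Fin using (Fin; toℕ)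
open import Data.Fin.Subset using (Subset; inside; outside; ∣_∣)
open import Data.Vec using (Vec; []; _∷_; lookup)
open import Data.List using (List; []; _∷_; [_]; map; _++_; concatMap; allFin; length; filterᵇ)
open import Data.Bool.ListAction using (any)
open import Data.Product using (_×_; _,_)
open import Data.Integer using (+_)
open import Data.Rational using (ℚ; _/_; _<_; _≤_; _*_; _-_; 1ℚ)
import Data.Nat as N

-- Tuples in U^m with U = ℕ (separation only depends on equality of entries,
-- so any alphabet can be relabelled into ℕ).
Tuple : ℕ → Set
Tuple m = Fin m → ℕ

DataSet : ℕ → ℕ → Set
DataSet n m = Fin n → Tuple m

separates : ∀ {m} → Subset m → Tuple m → Tuple m → Bool
separates {m} A x y = any (λ k → lookup A k ∧ not (x k ≡ᵇ y k)) (allFin m)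

allSubsets : ∀ n → List (Subset n)
allSubsets zero = [ [] ]
allSubsets (suc n) = map (inside ∷_) (allSubsets n) ++ map (outside ∷_) (allSubsets n)

pairs : ∀ n → List (Fin n × Fin n)
pairs n = concatMap (λ i → concatMap (λ j → if toℕ i <ᵇ toℕ j then [ (i , j) ] else []) (allFin n)) (allFin n)

numSeparated : ∀ {n m} → DataSet n m → Subset m → ℕ
numSeparated {n} D A = length (filterᵇ (λ { (i , j) → separates A (D i) (D j) }) (pairs n))

ℕtoℚ : ℕ → ℚ
ℕtoℚ k = + k / 1

Bad : ∀ {n m} → ℚ → DataSet n m → Subset m → Set
Bad {n} ε D A = ℕtoℚ (numSeparated D A) < (1ℚ - ε) * ℕtoℚ (n C 2)

rejects : ∀ {n m} → DataSet n m → Subset m → Subset n → Bool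
rejects {n} D A S =
  any (λ { (i , j) → lookup S i ∧ lookup S j ∧ not (separates A (D i) (D j)) }) (pairs n)

numAccepting : ∀ {n m} → DataSet n m → Subset m → ℕ → ℕ
numAccepting {n} D A r =
  length (filterᵇ (λ S → (∣ S ∣ ≡ᵇ r) ∧ not (rejects D A S)) (allSubsets n))

-- expScaled N x = N! * Σ_{k=0}^{N} x^k / k!   (a natural number)
expScaled : ℕ → ℕ → ℕ
expScaled zero x = 1
expScaled (suc N) x = suc N N.* expScaled N x + x ^ suc N

-- The uniform r-sample rejects A with probability ≥ 1 - e^{-m}, i.e. the acceptance
-- probability p = numAccepting / (n C r) satisfies p ≤ e^{-m}, i.e. p * e^m ≤ 1.
-- Since e^m = sup_N Σ_{k≤N} m^k/k!, this is equivalent to: for every N,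
-- p * Σ_{k≤N} m^k/k! ≤ 1, i.e. numAccepting * expScaled N m ≤ (n C r) * N!.
RejectsWHP : ∀ {n m} → DataSet n m → Subset m → ℕ → Set
RejectsWHP {n} {m} D A r = ∀ N → numAccepting D A r N.* expScaled N m N.≤ (n C r) N.* (N !)

-- Write ε = p/d and let q be the largest integer with 256·p·q² ≤ d, so that q ≈ 1/(16√ε).
-- For m ≥ 1 take L = m + 2 identical all-zero tuples followed by M = 8qL pairwise distinct
-- ones, n = L + M tuples in all. The full coordinate set [m] separates every pair except the
-- C(L,2) pairs inside the cluster, and C(L,2) > ε·C(n,2), so [m] is bad. A sample avoiding the
-- cluster is never rejected, hence the acceptance probability is at least
-- C(M,r)/C(n,r) ≥ (8q/(8q+2))^r, which for r ≤ qm exceeds 2^(-m) ≥ (Σ_{k≤m} m^k/k!)^(-1).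
-- So a tester rejecting [m] with probability ≥ 1 - e^(-m) needs r > qm, i.e. r²ε ≥ (m/32)².
module Submission where

open import Defs

module Combinatorics where

  open import Data.Nat using (ℕ; zero; suc; pred; >-nonZero; _+_; _*_; _∸_; _^_; _!; _≤_; _<_; z≤n; s≤s; z<s; _<ᵇ_; _≡ᵇ_)
  open import Data.Nat.Properties
  open import Data.Nat.Combinatorics using (_C_; nC1≡n; nCk+nC[k+1]≡[n+1]C[k+1])
  open import Data.Nat.Solver using (module +-*-Solver)
  open +-*-Solver using (solve; _:=_; con; _:+_; _:*_)
  open import Algebra.Properties.CommutativeSemigroup *-commutativeSemigroup using (x∙yz≈y∙xz; xy∙z≈y∙xz; xy∙z≈x∙zy)
  open import Data.Bool using (Bool; true; false; _∧_; not; T; T?; if_then_else_)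
  open import Data.Bool.Properties using (T-∧)
  open import Data.Bool.ListAction using (any)
  open import Data.Unit using (tt)
  open import Data.Product using (_×_; _,_; proj₂; ∃-syntax)
  open import Data.Fin using (Fin; toℕ) renaming (zero to fzero; suc to fsuc)
  open import Data.Fin.Subset using (Subset; inside; outside; ∣_∣; ⊤) renaming (⊥ to ∅)
  open import Data.Vec using (_∷_; lookup) renaming (_++_ to _++ᵛ_)
  open import Data.List using (List; []; _∷_; [_]; map; _++_; concatMap; allFin; tabulate; length; filterᵇ)
  open import Data.List.Properties using (filter-++; length-++; filter-none; map-tabulate; concatMap-map; map-concatMap; concatMap-cong; concatMap-pure)
  open import Data.List.Relation.Unary.All as All using (All; []; _∷_)
  open import Data.List.Relation.Unary.All.Properties using (map⁺; tabulate⁺; concat⁺; All¬⇒¬Any)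
  open import Data.List.Relation.Unary.Any.Properties using (any⁺; any⁻)
  open import Data.List.Membership.Propositional using (lose)
  open import Data.List.Membership.Propositional.Properties using (∈-allFin)
  open import Function using (_∘_; Equivalence)
  open import Relation.Nullary using (¬_; contradiction; yes; no)
  open import Relation.Nullary.Reflects using (ofʸ)
  open import Relation.Unary using (Decidable)
  open import Relation.Binary.PropositionalEquality hiding ([_])

  T-not⁺ : ∀ {b} → ¬ T b → T (not b)
  T-not⁺ {false} _  = tt
  T-not⁺ {true}  ¬b = ¬b tt

  T-not⁻ : ∀ {b} → T (not b) → ¬ T b
  T-not⁻ {false} _ ()
  T-not⁻ {true}  ()

  count : {A : Set} → (A → Bool) → List A → ℕ
  count p xs = length (filterᵇ p xs)

  count-++ : ∀ {A : Set} (p : A → Bool) xs ys → count p (xs ++ ys) ≡ count p xs + count p ys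
  count-++ p xs ys = trans (cong length (filter-++ (T? ∘ p) xs ys)) (length-++ (filterᵇ p xs))

  count-map : ∀ {A B : Set} (p : B → Bool) (f : A → B) xs → count p (map f xs) ≡ count (p ∘ f) xs
  count-map p f [] = refl
  count-map p f (x ∷ xs) with p (f x)
  ... | true  = cong suc (count-map p f xs)
  ... | false = count-map p f xs

  count-false : ∀ {A : Set} (xs : List A) → count (λ _ → false) xs ≡ 0
  count-false xs = cong length (filter-none (T? ∘ λ _ → false) (All.universal (λ _ ()) xs))

  count-mono : ∀ {A : Set} (p q : A → Bool) {xs} → All (λ x → T (p x) → T (q x)) xs → count p xs ≤ count q xs
  count-mono p q [] = z≤n
  count-mono p q {x ∷ _} (p⇒q ∷ ps) with p x | q x | p⇒q
  ... | true  | true  | _   = s≤s (count-mono p q ps)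
  ... | true  | false | p⇒q = contradiction tt p⇒q
  ... | false | true  | _   = m≤n⇒m≤1+n (count-mono p q ps)
  ... | false | false | _   = count-mono p q ps

  count-tabulate-fsuc : ∀ n (p : Fin (suc n) → Bool) → count p (tabulate fsuc) ≡ count (p ∘ fsuc) (allFin n)
  count-tabulate-fsuc n p = trans (cong (count p) (sym (map-tabulate (λ i → i) fsuc))) (count-map p fsuc (allFin n))

  -- Binomial coefficients

  pascal : ∀ n k → suc n C suc k ≡ n C k + n C suc k
  pascal n k = sym (nCk+nC[k+1]≡[n+1]C[k+1] n k)

  C2-suc : ∀ n → suc n C 2 ≡ n + n C 2
  C2-suc n = trans (pascal n 1) (cong (_+ n C 2) (nC1≡n n))

  2*C2+n≡n*n : ∀ n → 2 * (n C 2) + n ≡ n * n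
  2*C2+n≡n*n zero = refl
  2*C2+n≡n*n (suc n) = begin
    2 * (suc n C 2) + suc n           ≡⟨ cong (λ x → 2 * x + suc n) (C2-suc n) ⟩
    2 * (n + n C 2) + suc n           ≡⟨ solve 2 (λ n c → con 2 :* (n :+ c) :+ (con 1 :+ n)
                                                     := (con 2 :* c :+ n) :+ (con 2 :* n :+ con 1)) refl n (n C 2) ⟩
    (2 * (n C 2) + n) + (2 * n + 1)   ≡⟨ cong (_+ (2 * n + 1)) (2*C2+n≡n*n n) ⟩
    n * n + (2 * n + 1)               ≡⟨ solve 1 (λ n → n :* n :+ (con 2 :* n :+ con 1) := (con 1 :+ n) :* (con 1 :+ n)) refl n ⟩
    suc n * suc n                     ∎
    where open ≡-Reasoning

  C-absorb : ∀ n k → suc k * (suc n C suc k) ≡ suc n * (n C k)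
  C-absorb zero    zero    = refl
  C-absorb zero    (suc k) = trans (cong (suc (suc k) *_) (pascal 0 (suc k))) (*-zeroʳ (suc (suc k)))
  C-absorb (suc n) zero    = trans (*-identityˡ _) (trans (nC1≡n (suc (suc n))) (sym (*-identityʳ _)))
  C-absorb (suc n) (suc k) = begin
    suc (suc k) * (suc (suc n) C suc (suc k))   ≡⟨ cong (suc (suc k) *_) (pascal (suc n) (suc k)) ⟩
    suc (suc k) * (a + b)                       ≡⟨ solve 3 (λ k a b → (con 2 :+ k) :* (a :+ b)
                                                             := ((con 1 :+ k) :* a :+ (con 2 :+ k) :* b) :+ a) refl k a b ⟩
    (suc k * a + suc (suc k) * b) + a           ≡⟨ cong₂ (λ x y → (x + y) + a) (C-absorb n k) (C-absorb n (suc k)) ⟩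
    (suc n * c + suc n * d) + a                 ≡⟨ cong ((suc n * c + suc n * d) +_) (pascal n k) ⟩
    (suc n * c + suc n * d) + (c + d)           ≡⟨ solve 3 (λ n c d → ((con 1 :+ n) :* c :+ (con 1 :+ n) :* d) :+ (c :+ d)
                                                             := (con 2 :+ n) :* (c :+ d)) refl n c d ⟩
    suc (suc n) * (c + d)                       ≡⟨ cong (suc (suc n) *_) (pascal n k) ⟨
    suc (suc n) * (suc n C suc k)               ∎
    where
    open ≡-Reasoning
    a = suc n C suc k
    b = suc n C suc (suc k)
    c = n C k
    d = n C suc k

  C-step : ∀ n k → suc k * (n C suc k) ≡ (n ∸ k) * (n C k)
  C-step n k = begin
    suc k * (n C suc k)                                         ≡⟨ m+n∸m≡n (suc k * (n C k)) _ ⟨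
    (suc k * (n C k) + suc k * (n C suc k)) ∸ suc k * (n C k)   ≡⟨ cong (_∸ suc k * (n C k)) absorbed ⟩
    suc n * (n C k) ∸ suc k * (n C k)                           ≡⟨ *-distribʳ-∸ (n C k) (suc n) (suc k) ⟨
    (n ∸ k) * (n C k)                                           ∎
    where
    open ≡-Reasoning
    absorbed : suc k * (n C k) + suc k * (n C suc k) ≡ suc n * (n C k)
    absorbed = trans (sym (*-distribˡ-+ (suc k) (n C k) _)) (trans (cong (suc k *_) (sym (pascal n k))) (C-absorb n k))

  C-pos : ∀ n k → k ≤ n → 0 < n C k
  C-pos n       zero    _         = s≤s z≤n
  C-pos (suc n) (suc k) (s≤s k≤n) = ≤-trans (C-pos n k k≤n) (≤-trans (m≤m+n (n C k) _) (≤-reflexive (sym (pascal n k))))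

  C-ratio : ∀ n M a b r → (∀ i → i < r → (n ∸ i) * a ≤ b * (M ∸ i)) → (n C r) * a ^ r ≤ (M C r) * b ^ r
  C-ratio n M a b zero    _    = ≤-refl
  C-ratio n M a b (suc r) step = *-cancelˡ-≤ (suc r) (begin
    suc r * ((n C suc r) * a ^ suc r)   ≡⟨ *-assoc (suc r) (n C suc r) (a ^ suc r) ⟨
    (suc r * (n C suc r)) * a ^ suc r   ≡⟨ cong (_* a ^ suc r) (C-step n r) ⟩
    ((n ∸ r) * (n C r)) * (a * a ^ r)   ≡⟨ solve 4 (λ u c a y → (u :* c) :* (a :* y) := (c :* y) :* (u :* a)) refl (n ∸ r) (n C r) a (a ^ r) ⟩
    ((n C r) * a ^ r) * ((n ∸ r) * a)   ≤⟨ *-mono-≤ (C-ratio n M a b r (λ i i<r → step i (m<n⇒m<1+n i<r))) (step r ≤-refl) ⟩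
    ((M C r) * b ^ r) * (b * (M ∸ r))   ≡⟨ solve 4 (λ c y b u → (c :* y) :* (b :* u) := (u :* c) :* (b :* y)) refl (M C r) (b ^ r) b (M ∸ r) ⟩
    ((M ∸ r) * (M C r)) * (b * b ^ r)   ≡⟨ cong (_* b ^ suc r) (C-step M r) ⟨
    (suc r * (M C suc r)) * b ^ suc r   ≡⟨ *-assoc (suc r) (M C suc r) (b ^ suc r) ⟩
    suc r * ((M C suc r) * b ^ suc r)   ∎)
    where open ≤-Reasoning

  count-allSubsets-suc : ∀ M (p : Subset (suc M) → Bool) →
    count p (allSubsets (suc M)) ≡ count (p ∘ (inside ∷_)) (allSubsets M) + count (p ∘ (outside ∷_)) (allSubsets M)
  count-allSubsets-suc M p = trans (count-++ p (map (inside ∷_) X) _) (cong₂ _+_ (count-map p _ X) (count-map p _ X))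
    where X = allSubsets M

  count-allSubsets-size : ∀ M r → count (λ S → ∣ S ∣ ≡ᵇ r) (allSubsets M) ≡ M C r
  count-allSubsets-size zero    zero    = refl
  count-allSubsets-size zero    (suc r) = refl
  count-allSubsets-size (suc M) zero    = begin
    count (λ S → ∣ S ∣ ≡ᵇ 0) (allSubsets (suc M))                                   ≡⟨ count-allSubsets-suc M _ ⟩
    count (λ _ → false) (allSubsets M) + count (λ S → ∣ S ∣ ≡ᵇ 0) (allSubsets M)
                                                                                    ≡⟨ cong₂ _+_ (count-false (allSubsets M)) (count-allSubsets-size M 0) ⟩
    1                                                                               ∎
    where open ≡-Reasoning
  count-allSubsets-size (suc M) (suc r) = begin
    count (λ S → ∣ S ∣ ≡ᵇ suc r) (allSubsets (suc M))                                 ≡⟨ count-allSubsets-suc M _ ⟩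
    count (λ S → ∣ S ∣ ≡ᵇ r) (allSubsets M) + count (λ S → ∣ S ∣ ≡ᵇ suc r) (allSubsets M)
                                                                                      ≡⟨ cong₂ _+_ (count-allSubsets-size M r) (count-allSubsets-size M (suc r)) ⟩
    M C r + M C suc r                                                                 ≡⟨ pascal M r ⟨
    suc M C suc r                                                                     ∎
    where open ≡-Reasoning

  ∣∅++∣ : ∀ L {M} (S : Subset M) → ∣ ∅ {L} ++ᵛ S ∣ ≡ ∣ S ∣
  ∣∅++∣ zero    S = refl
  ∣∅++∣ (suc L) S = ∣∅++∣ L S

  lookup-∅++ : ∀ L {M} (S : Subset M) i → T (lookup (∅ {L} ++ᵛ S) i) → L ≤ toℕ i
  lookup-∅++ zero    S i        _  = z≤n
  lookup-∅++ (suc L) S (fsuc i) Si = s≤s (lookup-∅++ L S i Si)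

  count-∅++ : ∀ L M (p : Subset (L + M) → Bool) → count (p ∘ (∅ {L} ++ᵛ_)) (allSubsets M) ≤ count p (allSubsets (L + M))
  count-∅++ zero    M p = ≤-refl
  count-∅++ (suc L) M p = begin
    count (p ∘ (outside ∷_) ∘ (∅ {L} ++ᵛ_)) (allSubsets M)    ≤⟨ count-∅++ L M (p ∘ (outside ∷_)) ⟩
    count (p ∘ (outside ∷_)) X                                ≤⟨ m≤n+m _ _ ⟩
    count (p ∘ (inside ∷_)) X + count (p ∘ (outside ∷_)) X    ≡⟨ count-allSubsets-suc (L + M) p ⟨
    count p (allSubsets (suc L + M))                          ∎
    where
    open ≤-Reasoning
    X = allSubsets (L + M)

  orderedPair : ∀ {n} → Fin n → Fin n → List (Fin n × Fin n)
  orderedPair i j = if toℕ i <ᵇ toℕ j then [ (i , j) ] else []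

  pairs-ordered : ∀ n → All (λ (i , j) → toℕ i < toℕ j) (pairs n)
  pairs-ordered n = concat⁺ (map⁺ (tabulate⁺ λ i → concat⁺ (map⁺ (tabulate⁺ (ordered i)))))
    where
    ordered : ∀ i j → All (λ (i , j) → toℕ i < toℕ j) (orderedPair i j)
    ordered i j with toℕ i <ᵇ toℕ j | <ᵇ-reflects-< (toℕ i) (toℕ j)
    ... | true  | ofʸ i<j = i<j ∷ []
    ... | false | _       = []

  sucPair : ∀ {n} → Fin n × Fin n → Fin (suc n) × Fin (suc n)
  sucPair (i , j) = fsuc i , fsuc j

  concatMap-allFin-suc : ∀ {B : Set} n (f : Fin (suc n) → List B) →
    concatMap f (allFin (suc n)) ≡ f fzero ++ concatMap (f ∘ fsuc) (allFin n)
  concatMap-allFin-suc n f =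
    cong (f fzero ++_) (trans (cong (concatMap f) (sym (map-tabulate (λ i → i) fsuc))) (concatMap-map f fsuc (allFin n)))

  orderedPair-suc : ∀ {n} (i j : Fin n) → orderedPair (fsuc i) (fsuc j) ≡ map sucPair (orderedPair i j)
  orderedPair-suc i j with toℕ i <ᵇ toℕ j
  ... | true  = refl
  ... | false = refl

  pairs-suc : ∀ n → pairs (suc n) ≡ map (λ j → fzero , fsuc j) (allFin n) ++ map sucPair (pairs n)
  pairs-suc n = begin
    concatMap row (allFin (suc n))                          ≡⟨ concatMap-allFin-suc n row ⟩
    row fzero ++ concatMap (row ∘ fsuc) (allFin n)          ≡⟨ cong₂ _++_ first-row (concatMap-cong later-row (allFin n)) ⟩
    first ++ concatMap (map sucPair ∘ row′) (allFin n)      ≡⟨ cong (first ++_) (map-concatMap sucPair row′ (allFin n)) ⟨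
    first ++ map sucPair (pairs n)                          ∎
    where
    open ≡-Reasoning
    first = map (λ j → fzero , fsuc j) (allFin n)
    row : Fin (suc n) → List (Fin (suc n) × Fin (suc n))
    row i = concatMap (orderedPair i) (allFin (suc n))
    row′ : Fin n → List (Fin n × Fin n)
    row′ i = concatMap (orderedPair i) (allFin n)
    first-row : row fzero ≡ first
    first-row = trans (concatMap-allFin-suc n (orderedPair fzero))
                      (trans (sym (concatMap-map [_] (λ j → fzero , fsuc j) (allFin n))) (concatMap-pure first))
    later-row : ∀ i → row (fsuc i) ≡ map sucPair (row′ i)
    later-row i = trans (concatMap-allFin-suc n (orderedPair (fsuc i)))
                        (trans (concatMap-cong (orderedPair-suc i) (allFin n)) (sym (map-concatMap sucPair (orderedPair i) (allFin n))))

  count-allFin-≥ : ∀ n L → count (λ j → not (toℕ j <ᵇ L)) (allFin n) ≡ n ∸ L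
  count-allFin-≥ zero    zero    = refl
  count-allFin-≥ zero    (suc L) = refl
  count-allFin-≥ (suc n) zero    = cong suc (trans (count-tabulate-fsuc n _) (count-allFin-≥ n zero))
  count-allFin-≥ (suc n) (suc L) = trans (count-tabulate-fsuc n _) (count-allFin-≥ n L)

  pairsNotBelow : ℕ → ℕ → ℕ
  pairsNotBelow n L = count (λ (_ , j) → not (toℕ j <ᵇ L)) (pairs n)

  pairsNotBelow-suc : ∀ n L → pairsNotBelow (suc n) L ≡ (n ∸ pred L) + pairsNotBelow n (pred L)
  pairsNotBelow-suc n L rewrite pairs-suc n =
    trans (count-++ p (map (λ j → fzero , fsuc j) (allFin n)) (map sucPair (pairs n)))
          (cong₂ _+_ (trans (count-map p _ (allFin n)) (first L)) (trans (count-map p sucPair (pairs n)) (later L)))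
    where
    p : Fin (suc n) × Fin (suc n) → Bool
    p (_ , j) = not (toℕ j <ᵇ L)
    first : ∀ L → count (λ j → not (suc (toℕ j) <ᵇ L)) (allFin n) ≡ n ∸ pred L
    first zero    = count-allFin-≥ n zero
    first (suc L) = count-allFin-≥ n L
    later : ∀ L → count (λ (_ , j) → not (suc (toℕ j) <ᵇ L)) (pairs n) ≡ pairsNotBelow n (pred L)
    later zero    = refl
    later (suc L) = refl

  pairsNotBelow+C2 : ∀ n L → L ≤ n → pairsNotBelow n L + L C 2 ≡ n C 2
  pairsNotBelow+C2 zero    zero    _ = refl
  pairsNotBelow+C2 (suc n) zero    _ = begin
    pairsNotBelow (suc n) 0 + 0    ≡⟨ cong (_+ 0) (pairsNotBelow-suc n 0) ⟩
    n + pairsNotBelow n 0 + 0      ≡⟨ +-assoc n _ 0 ⟩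
    n + (pairsNotBelow n 0 + 0)    ≡⟨ cong (n +_) (pairsNotBelow+C2 n 0 z≤n) ⟩
    n + n C 2                      ≡⟨ C2-suc n ⟨
    suc n C 2                      ∎
    where open ≡-Reasoning
  pairsNotBelow+C2 (suc n) (suc L) (s≤s L≤n) = begin
    pairsNotBelow (suc n) (suc L) + suc L C 2    ≡⟨ cong₂ _+_ (pairsNotBelow-suc n (suc L)) (C2-suc L) ⟩
    (n ∸ L + pairsNotBelow n L) + (L + L C 2)    ≡⟨ solve 4 (λ a b l c → (a :+ b) :+ (l :+ c) := (a :+ l) :+ (b :+ c)) refl (n ∸ L) _ L _ ⟩
    (n ∸ L + L) + (pairsNotBelow n L + L C 2)    ≡⟨ cong₂ _+_ (m∸n+n≡m L≤n) (pairsNotBelow+C2 n L L≤n) ⟩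
    n + n C 2                                    ≡⟨ C2-suc n ⟨
    suc n C 2                                    ∎
    where open ≡-Reasoning

  -- Exponential and power estimates

  bernoulli : ∀ a N → a ^ N * (a + N) ≤ a * suc a ^ N
  bernoulli a zero    = ≤-reflexive (trans (*-identityˡ (a + 0)) (trans (+-identityʳ a) (sym (*-identityʳ a))))
  bernoulli a (suc N) = begin
    a ^ suc N * (a + suc N)                ≤⟨ m≤m+n _ (a ^ N * N) ⟩
    a ^ suc N * (a + suc N) + a ^ N * N    ≡⟨ solve 3 (λ a x N → (a :* x) :* (a :+ (con 1 :+ N)) :+ x :* N
                                                        := (con 1 :+ a) :* (x :* (a :+ N))) refl a (a ^ N) N ⟩
    suc a * (a ^ N * (a + N))              ≤⟨ *-monoʳ-≤ (suc a) (bernoulli a N) ⟩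
    suc a * (a * suc a ^ N)                ≡⟨ x∙yz≈y∙xz (suc a) a (suc a ^ N) ⟩
    a * suc a ^ suc N                      ∎
    where open ≤-Reasoning

  N!*2^N≤[1+N]^N : ∀ N → N ! * 2 ^ N ≤ suc N ^ N
  N!*2^N≤[1+N]^N zero    = ≤-refl
  N!*2^N≤[1+N]^N (suc N) = *-cancelˡ-≤ (suc N) (begin
    suc N * (suc N ! * 2 ^ suc N)               ≡⟨ solve 3 (λ a f t → a :* ((a :* f) :* (con 2 :* t))
                                                             := a :* ((f :* t) :* (a :+ a))) refl (suc N) (N !) (2 ^ N) ⟩
    suc N * ((N ! * 2 ^ N) * (suc N + suc N))   ≤⟨ *-monoʳ-≤ (suc N) (*-monoˡ-≤ (suc N + suc N) (N!*2^N≤[1+N]^N N)) ⟩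
    suc N * (suc N ^ N * (suc N + suc N))       ≡⟨ *-assoc (suc N) (suc N ^ N) _ ⟨
    suc N ^ suc N * (suc N + suc N)             ≤⟨ bernoulli (suc N) (suc N) ⟩
    suc N * suc (suc N) ^ suc N                 ∎)
    where open ≤-Reasoning

  N!*2^N≤expScaled : ∀ N x → N ≤ x → N ! * 2 ^ N ≤ expScaled N x
  N!*2^N≤expScaled zero    x _   = ≤-refl
  N!*2^N≤expScaled (suc N) x N<x = begin
    suc N ! * 2 ^ suc N                             ≡⟨ solve 3 (λ a f t → (a :* f) :* (con 2 :* t) := a :* (f :* t) :+ a :* (f :* t))
                                                                 refl (suc N) (N !) (2 ^ N) ⟩
    suc N * (N ! * 2 ^ N) + suc N * (N ! * 2 ^ N)   ≤⟨ +-mono-≤ (*-monoʳ-≤ (suc N) (N!*2^N≤expScaled N x (<⇒≤ N<x)))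
                                                                 (*-monoʳ-≤ (suc N) (N!*2^N≤[1+N]^N N)) ⟩
    suc N * expScaled N x + suc N ^ suc N           ≤⟨ +-monoʳ-≤ (suc N * expScaled N x) (^-monoˡ-≤ (suc N) N<x) ⟩
    expScaled (suc N) x                             ∎
    where open ≤-Reasoning

  bernoulli-upper : ∀ j t q u → u + t * q ≤ j → (j + t) ^ q * u ≤ j ^ q * j
  bernoulli-upper j t zero    u h = subst₂ _≤_ (sym (*-identityˡ u)) (sym (*-identityˡ j)) (≤-trans (m≤m+n u _) h)
  bernoulli-upper j t (suc q) u h = begin
    (j + t) ^ suc q * u            ≡⟨ xy∙z≈y∙xz (j + t) ((j + t) ^ q) u ⟩
    (j + t) ^ q * ((j + t) * u)    ≤⟨ *-monoʳ-≤ ((j + t) ^ q) step ⟩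
    (j + t) ^ q * (j * (u + t))    ≡⟨ x∙yz≈y∙xz ((j + t) ^ q) j (u + t) ⟩
    j * ((j + t) ^ q * (u + t))    ≤⟨ *-monoʳ-≤ j (bernoulli-upper j t q (u + t) (subst (_≤ j) shift h)) ⟩
    j * (j ^ q * j)                ≡⟨ *-assoc j (j ^ q) j ⟨
    j ^ suc q * j                  ∎
    where
    open ≤-Reasoning
    shift : u + t * suc q ≡ u + t + t * q
    shift = solve 3 (λ u t q → u :+ t :* (con 1 :+ q) := u :+ t :+ t :* q) refl u t q
    u≤j : u ≤ j
    u≤j = ≤-trans (m≤m+n u _) h
    step : (j + t) * u ≤ j * (u + t)
    step = begin
      (j + t) * u      ≡⟨ solve 3 (λ j t u → (j :+ t) :* u := j :* u :+ u :* t) refl j t u ⟩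
      j * u + u * t    ≤⟨ +-monoʳ-≤ (j * u) (*-monoˡ-≤ t u≤j) ⟩
      j * u + j * t    ≡⟨ *-distribˡ-+ j u t ⟨
      j * (u + t)      ∎

  ^-distribʳ-* : ∀ a b m → (a * b) ^ m ≡ a ^ m * b ^ m
  ^-distribʳ-* a b zero    = refl
  ^-distribʳ-* a b (suc m) = begin
    (a * b) * (a * b) ^ m        ≡⟨ cong ((a * b) *_) (^-distribʳ-* a b m) ⟩
    (a * b) * (a ^ m * b ^ m)    ≡⟨ solve 4 (λ a b x y → (a :* b) :* (x :* y) := (a :* x) :* (b :* y)) refl a b (a ^ m) (b ^ m) ⟩
    (a * a ^ m) * (b * b ^ m)    ∎
    where open ≡-Reasoning

  [8q+2]^q<2*[8q]^q : ∀ q → 1 ≤ q → (8 * q + 2) ^ q < 2 * (8 * q) ^ q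
  [8q+2]^q<2*[8q]^q q 1≤q = *-cancelˡ-< 3 _ _ (begin-strict
    3 * x          ≤⟨ *-cancelʳ-≤ (3 * x) (4 * y) (2 * q) {{>-nonZero (*-monoʳ-< 2 1≤q)}} (begin
      3 * x * (2 * q)    ≡⟨ solve 2 (λ x q → con 3 :* x :* (con 2 :* q) := x :* (con 6 :* q)) refl x q ⟩
      x * (6 * q)        ≤⟨ bernoulli-upper (8 * q) 2 q (6 * q) (≤-reflexive (solve 1 (λ q → con 6 :* q :+ con 2 :* q := con 8 :* q) refl q)) ⟩
      y * (8 * q)        ≡⟨ solve 2 (λ y q → y :* (con 8 :* q) := con 4 :* y :* (con 2 :* q)) refl y q ⟩
      4 * y * (2 * q)    ∎) ⟩
    4 * y          <⟨ *-monoˡ-< y {{>-nonZero y>0}} (m<n+m 4 {2} z<s) ⟩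
    6 * y          ≡⟨ *-assoc 3 2 y ⟩
    3 * (2 * y)    ∎)
    where
    open ≤-Reasoning
    x = (8 * q + 2) ^ q
    y = (8 * q) ^ q
    y>0 : 0 < y
    y>0 = m^n>0 (8 * q) {{>-nonZero (*-monoʳ-< 8 1≤q)}} q

  [8q+2]^qm<2^m*[8q]^qm : ∀ q m → 1 ≤ q → (8 * q + 2) ^ (q * suc m) < 2 ^ suc m * (8 * q) ^ (q * suc m)
  [8q+2]^qm<2^m*[8q]^qm q m 1≤q = begin-strict
    (8 * q + 2) ^ (q * suc m)            ≡⟨ ^-*-assoc (8 * q + 2) q (suc m) ⟨
    ((8 * q + 2) ^ q) ^ suc m            <⟨ ^-monoˡ-< (suc m) ([8q+2]^q<2*[8q]^q q 1≤q) ⟩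
    (2 * (8 * q) ^ q) ^ suc m            ≡⟨ ^-distribʳ-* 2 ((8 * q) ^ q) (suc m) ⟩
    2 ^ suc m * ((8 * q) ^ q) ^ suc m    ≡⟨ cong (2 ^ suc m *_) (^-*-assoc (8 * q) q (suc m)) ⟩
    2 ^ suc m * (8 * q) ^ (q * suc m)    ∎
    where open ≤-Reasoning

  ^-ratio-extend : ∀ {a b} x y r e → a ≤ b → r ≤ e → x * a ^ r ≤ y * b ^ r → x * a ^ e ≤ y * b ^ e
  ^-ratio-extend {a} {b} x y r e a≤b r≤e h = subst (λ k → x * a ^ k ≤ y * b ^ k) (m+[n∸m]≡n r≤e) (begin
    x * a ^ (r + s)        ≡⟨ cong (x *_) (^-distribˡ-+-* a r s) ⟩
    x * (a ^ r * a ^ s)    ≡⟨ *-assoc x (a ^ r) (a ^ s) ⟨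
    x * a ^ r * a ^ s      ≤⟨ *-mono-≤ h (^-monoˡ-≤ s a≤b) ⟩
    y * b ^ r * b ^ s      ≡⟨ *-assoc y (b ^ r) (b ^ s) ⟩
    y * (b ^ r * b ^ s)    ≡⟨ cong (y *_) (^-distribˡ-+-* b r s) ⟨
    y * b ^ (r + s)        ∎)
    where
    open ≤-Reasoning
    s = e ∸ r

  -- The clustered data set

  separates-≗ : ∀ {m} (A : Subset m) {x y : Tuple m} → (∀ k → x k ≡ y k) → ¬ T (separates A x y)
  separates-≗ {m} A {x} {y} x≗y = All¬⇒¬Any (tabulate⁺ unseparated) ∘ any⁻ _ (allFin m)
    where
    unseparated : ∀ k → ¬ T (lookup A k ∧ not (x k ≡ᵇ y k))
    unseparated k t = T-not⁻ (proj₂ (Equivalence.to T-∧ t)) (≡⇒≡ᵇ (x k) (y k) (x≗y k))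

  separates-at : ∀ {m} (A : Subset m) {x y : Tuple m} k → T (lookup A k) → x k ≢ y k → T (separates A x y)
  separates-at A {x} {y} k k∈A xk≢yk =
    any⁺ _ (lose (∈-allFin k) (Equivalence.from T-∧ (k∈A , T-not⁺ (xk≢yk ∘ ≡ᵇ⇒≡ (x k) (y k)))))

  -- Tuples with index below L are all zero; the others are constant with pairwise distinct values.
  cluster : (L M m : ℕ) → DataSet (L + M) m
  cluster L M m i _ = suc (toℕ i) ∸ L

  cluster-low : ∀ {L M m} i k → toℕ i < L → cluster L M m i k ≡ 0
  cluster-low i k i<L = m≤n⇒m∸n≡0 i<L

  cluster-high : ∀ {L M m} i j k → L ≤ toℕ i → toℕ i < toℕ j → cluster L M m i k ≢ cluster L M m j k
  cluster-high i j k L≤i i<j = <⇒≢ (∸-monoˡ-< (s≤s i<j) (m≤n⇒m≤1+n L≤i))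

  numSeparated-cluster : ∀ L M m (A : Subset m) → numSeparated (cluster L M m) A ≤ pairsNotBelow (L + M) L
  numSeparated-cluster L M m A = count-mono _ _ (All.map (λ {(i , j)} → separated⇒high i j) (pairs-ordered (L + M)))
    where
    separated⇒high : ∀ i j → toℕ i < toℕ j → T (separates A (cluster L M m i) (cluster L M m j)) → T (not (toℕ j <ᵇ L))
    separated⇒high i j i<j sep = T-not⁺ λ j<ᵇL →
      let j<L = <ᵇ⇒< (toℕ j) L j<ᵇL in
      separates-≗ A (λ k → trans (cluster-low i k (<-trans i<j j<L)) (sym (cluster-low j k j<L))) sep

  cluster-accepts : ∀ L M m (S : Subset (L + M)) → (∀ i → T (lookup S i) → L ≤ toℕ i) →
    ¬ T (rejects (cluster L M (suc m)) ⊤ S)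
  cluster-accepts L M m S high =
    All¬⇒¬Any (All.map (λ {(i , j)} → unrejected i j) (pairs-ordered (L + M))) ∘ any⁻ _ (pairs (L + M))
    where
    D = cluster L M (suc m)
    unrejected : ∀ i j → toℕ i < toℕ j → ¬ T (lookup S i ∧ lookup S j ∧ not (separates ⊤ (D i) (D j)))
    unrejected i j i<j t with Equivalence.to T-∧ t
    ... | i∈S , rest = T-not⁻ (proj₂ (Equivalence.to (T-∧ {lookup S j}) rest)) separated
      where
      separated : T (separates ⊤ (D i) (D j))
      separated = separates-at ⊤ {D i} {D j} fzero tt (cluster-high {m = suc m} i j fzero (high i i∈S) i<j)

  C≤numAccepting-cluster : ∀ L M m r → M C r ≤ numAccepting (cluster L M (suc m)) ⊤ r
  C≤numAccepting-cluster L M m r = begin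
    M C r                                              ≡⟨ count-allSubsets-size M r ⟨
    count (λ S → ∣ S ∣ ≡ᵇ r) (allSubsets M)            ≤⟨ count-mono _ _ (All.universal accepted (allSubsets M)) ⟩
    count (accepting ∘ (∅ {L} ++ᵛ_)) (allSubsets M)    ≤⟨ count-∅++ L M accepting ⟩
    numAccepting (cluster L M (suc m)) ⊤ r             ∎
    where
    open ≤-Reasoning
    accepting : Subset (L + M) → Bool
    accepting S = (∣ S ∣ ≡ᵇ r) ∧ not (rejects (cluster L M (suc m)) ⊤ S)
    accepted : ∀ S → T (∣ S ∣ ≡ᵇ r) → T (accepting (∅ {L} ++ᵛ S))
    accepted S size = Equivalence.from T-∧
      (subst (λ k → T (k ≡ᵇ r)) (sym (∣∅++∣ L S)) size , T-not⁺ (cluster-accepts L M m (∅ ++ᵛ S) (lookup-∅++ L S)))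

  cluster-ratio-step : ∀ L j i → 2 * i ≤ j * L → (L + j * L ∸ i) * j ≤ (j + 2) * (j * L ∸ i)
  cluster-ratio-step L j i 2i≤jL = begin
    (L + j * L ∸ i) * j    ≡⟨ cong (_* j) (+-∸-assoc L i≤jL) ⟩
    (L + t) * j            ≡⟨ solve 3 (λ L t j → (L :+ t) :* j := j :* L :+ t :* j) refl L t j ⟩
    j * L + t * j          ≡⟨ cong (_+ t * j) (m+[n∸m]≡n i≤jL) ⟨
    i + t + t * j          ≤⟨ +-monoˡ-≤ (t * j) (+-monoˡ-≤ t i≤t) ⟩
    t + t + t * j          ≡⟨ solve 2 (λ t j → t :+ t :+ t :* j := (j :+ con 2) :* t) refl t j ⟩
    (j + 2) * t            ∎
    where
    open ≤-Reasoning
    t = j * L ∸ i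
    i≤jL : i ≤ j * L
    i≤jL = ≤-trans (m≤m+n i (i + 0)) 2i≤jL
    i≤t : i ≤ t
    i≤t = +-cancelˡ-≤ i i t (begin
      i + i    ≡⟨ cong (i +_) (+-identityʳ i) ⟨
      2 * i    ≤⟨ 2i≤jL ⟩
      j * L    ≡⟨ m+[n∸m]≡n i≤jL ⟨
      i + t    ∎)

  C[L+M,r]<C[M,r]*2^m : ∀ q m L r → 1 ≤ q → suc m ≤ L → r ≤ q * suc m →
    (L + 8 * q * L) C r < ((8 * q * L) C r) * 2 ^ suc m
  C[L+M,r]<C[M,r]*2^m q m L r 1≤q m<L r≤qm = *-cancelʳ-< (j ^ e) (n C r) ((M C r) * 2 ^ suc m) (begin-strict
    (n C r) * j ^ e                ≤⟨ ^-ratio-extend (n C r) (M C r) r e (m≤m+n j 2) r≤qm (C-ratio n M j (j + 2) r step) ⟩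
    (M C r) * (j + 2) ^ e          <⟨ *-monoʳ-< (M C r) {{>-nonZero (C-pos M r r≤M)}} ([8q+2]^qm<2^m*[8q]^qm q m 1≤q) ⟩
    (M C r) * (2 ^ suc m * j ^ e)  ≡⟨ *-assoc (M C r) (2 ^ suc m) (j ^ e) ⟨
    (M C r) * 2 ^ suc m * j ^ e    ∎)
    where
    open ≤-Reasoning
    j = 8 * q
    M = j * L
    n = L + M
    e = q * suc m
    r≤qL : r ≤ q * L
    r≤qL = ≤-trans r≤qm (*-monoʳ-≤ q m<L)
    r≤M : r ≤ M
    r≤M = ≤-trans r≤qL (*-monoˡ-≤ L (m≤n*m q 8))
    step : ∀ i → i < r → (n ∸ i) * j ≤ (j + 2) * (M ∸ i)
    step i i<r = cluster-ratio-step L j i (begin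
      2 * i          ≤⟨ *-monoʳ-≤ 2 (≤-trans (<⇒≤ i<r) r≤qL) ⟩
      2 * (q * L)    ≤⟨ *-monoˡ-≤ (q * L) (m≤m+n 2 6) ⟩
      8 * (q * L)    ≡⟨ *-assoc 8 q L ⟨
      j * L          ∎)

  cluster-¬rejectsWHP : ∀ q m L r → 1 ≤ q → suc m ≤ L → r ≤ q * suc m →
    ¬ RejectsWHP (cluster L (8 * q * L) (suc m)) ⊤ r
  cluster-¬rejectsWHP q m L r 1≤q m<L r≤qm rejecting = <-irrefl refl (begin-strict
    (n C r) * m′ !                                         <⟨ *-monoˡ-< (m′ !) {{m′ !≢0}} (C[L+M,r]<C[M,r]*2^m q m L r 1≤q m<L r≤qm) ⟩
    (M C r) * 2 ^ m′ * m′ !                                ≡⟨ xy∙z≈x∙zy (M C r) (2 ^ m′) (m′ !) ⟩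
    (M C r) * (m′ ! * 2 ^ m′)                              ≤⟨ *-monoʳ-≤ (M C r) (N!*2^N≤expScaled m′ m′ ≤-refl) ⟩
    (M C r) * expScaled m′ m′                              ≤⟨ *-monoˡ-≤ (expScaled m′ m′) (C≤numAccepting-cluster L M m r) ⟩
    numAccepting (cluster L M m′) ⊤ r * expScaled m′ m′    ≤⟨ rejecting m′ ⟩
    (n C r) * m′ !                                         ∎)
    where
    open ≤-Reasoning
    m′ = suc m
    M = 8 * q * L
    n = L + M

  few-unseparated-pairs : ∀ p d q L → 1 ≤ q → 2 ≤ L → 0 < d → 256 * p * (q * q) ≤ d →
    p * ((L + 8 * q * L) C 2) < d * (L C 2)
  few-unseparated-pairs p d q L 1≤q 2≤L d>0 hq = *-cancelˡ-< 512 _ _ (begin-strict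
    512 * (p * (n C 2))                   ≡⟨ solve 2 (λ p c → con 512 :* (p :* c) := con 256 :* p :* (con 2 :* c)) refl p (n C 2) ⟩
    256 * p * (2 * (n C 2))               ≤⟨ *-monoʳ-≤ (256 * p) (subst (2 * (n C 2) ≤_) (2*C2+n≡n*n n) (m≤m+n _ n)) ⟩
    256 * p * (n * n)                     ≤⟨ *-monoʳ-≤ (256 * p) (*-mono-≤ n≤9qL n≤9qL) ⟩
    256 * p * (9 * q * L * (9 * q * L))   ≡⟨ solve 3 (λ p q L → con 256 :* p :* (con 9 :* q :* L :* (con 9 :* q :* L))
                                                             := con 81 :* (con 256 :* p :* (q :* q) :* (L :* L))) refl p q L ⟩
    81 * (256 * p * (q * q) * (L * L))    ≤⟨ *-monoʳ-≤ 81 (*-monoˡ-≤ (L * L) hq) ⟩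
    81 * (d * (L * L))                    <⟨ *-monoˡ-< (d * (L * L)) {{>-nonZero (*-mono-< d>0 (*-mono-< L>0 L>0))}} (m<n+m 81 {47} z<s) ⟩
    128 * (d * (L * L))                   ≤⟨ +-cancelʳ-≤ (256 * (d * L)) _ _ (begin
      128 * (d * (L * L)) + 256 * (d * L)          ≤⟨ +-monoʳ-≤ (128 * (d * (L * L))) 256dL≤128dLL ⟩
      128 * (d * (L * L)) + 128 * (d * (L * L))    ≡⟨ solve 2 (λ d L → con 128 :* (d :* (L :* L)) :+ con 128 :* (d :* (L :* L))
                                                                   := con 256 :* d :* (L :* L)) refl d L ⟩
      256 * d * (L * L)                            ≡⟨ cong (256 * d *_) (2*C2+n≡n*n L) ⟨
      256 * d * (2 * (L C 2) + L)                  ≡⟨ solve 3 (λ d c L → con 256 :* d :* (con 2 :* c :+ L)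
                                                                   := con 512 :* (d :* c) :+ con 256 :* (d :* L)) refl d (L C 2) L ⟩
      512 * (d * (L C 2)) + 256 * (d * L)          ∎) ⟩
    512 * (d * (L C 2))                   ∎)
    where
    open ≤-Reasoning
    n = L + 8 * q * L
    L>0 : 0 < L
    L>0 = ≤-trans z<s 2≤L
    n≤9qL : n ≤ 9 * q * L
    n≤9qL = begin
      L + 8 * q * L        ≤⟨ +-monoˡ-≤ (8 * q * L) (subst (_≤ q * L) (*-identityˡ L) (*-monoˡ-≤ L 1≤q)) ⟩
      q * L + 8 * q * L    ≡⟨ solve 2 (λ q L → q :* L :+ con 8 :* q :* L := con 9 :* q :* L) refl q L ⟩
      9 * q * L            ∎
    256dL≤128dLL : 256 * (d * L) ≤ 128 * (d * (L * L))
    256dL≤128dLL = begin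
      256 * (d * L)          ≡⟨ solve 2 (λ d L → con 256 :* (d :* L) := con 128 :* (d :* (L :* con 2))) refl d L ⟩
      128 * (d * (L * 2))    ≤⟨ *-monoʳ-≤ 128 (*-monoʳ-≤ d (*-monoʳ-≤ L 2≤L)) ⟩
      128 * (d * (L * L))    ∎

  cluster-fewSeparated : ∀ p d q L m (A : Subset m) → 1 ≤ q → 2 ≤ L → 0 < d → 256 * p * (q * q) ≤ d →
    numSeparated (cluster L (8 * q * L) m) A * d + p * ((L + 8 * q * L) C 2) < d * ((L + 8 * q * L) C 2)
  cluster-fewSeparated p d q L m A 1≤q 2≤L d>0 hq = begin-strict
    s * d + p * (n C 2)               <⟨ +-monoʳ-< (s * d) (few-unseparated-pairs p d q L 1≤q 2≤L d>0 hq) ⟩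
    s * d + d * (L C 2)               ≡⟨ cong (_+ d * (L C 2)) (*-comm s d) ⟩
    d * s + d * (L C 2)               ≡⟨ *-distribˡ-+ d s (L C 2) ⟨
    d * (s + L C 2)                   ≤⟨ *-monoʳ-≤ d (+-monoˡ-≤ (L C 2) (numSeparated-cluster L (8 * q * L) m A)) ⟩
    d * (pairsNotBelow n L + L C 2)   ≡⟨ cong (d *_) (pairsNotBelow+C2 n L (m≤m+n L _)) ⟩
    d * (n C 2)                       ∎
    where
    open ≤-Reasoning
    n = L + 8 * q * L
    s = numSeparated (cluster L (8 * q * L) m) A

  -- Choosing the scale q

  last-true : ∀ (P : ℕ → Set) → Decidable P → P 0 → ∀ k → ¬ P k → ∃[ q ] P q × ¬ P (suc q)
  last-true P P? P0 zero    ¬P0   = contradiction P0 ¬P0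
  last-true P P? P0 (suc k) ¬Pk+1 with P? k
  ... | yes Pk  = k , Pk , ¬Pk+1
  ... | no  ¬Pk = last-true P P? P0 k ¬Pk

  scale : ∀ p d → 1 ≤ p → p * 256 < d → ∃[ q ] 1 ≤ q × 256 * p * (q * q) ≤ d × d < 256 * p * (suc q * suc q)
  scale p d 1≤p 256p<d with last-true (λ q → 256 * p * (q * q) ≤ d) (λ q → 256 * p * (q * q) ≤? d) P0 d ¬Pd
    where
    P0 : 256 * p * 0 ≤ d
    P0 = ≤-trans (≤-reflexive (*-zeroʳ (256 * p))) z≤n
    ¬Pd : ¬ 256 * p * (d * d) ≤ d
    ¬Pd = <⇒≱ (begin-strict
      d                    ≤⟨ m≤m*n d d {{>-nonZero d>0}} ⟩
      d * d                <⟨ m<m*n (d * d) (256 * p) {{>-nonZero (*-mono-< d>0 d>0)}} (≤-trans (m≤m+n 2 254) (*-monoʳ-≤ 256 1≤p)) ⟩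
      d * d * (256 * p)    ≡⟨ *-comm (d * d) (256 * p) ⟩
      256 * p * (d * d)    ∎)
      where
      open ≤-Reasoning
      d>0 : 0 < d
      d>0 = ≤-trans z<s 256p<d
  ... | zero  , _  , ¬P1    =
    contradiction (subst (_≤ d) (solve 1 (λ p → p :* con 256 := con 256 :* p :* (con 1 :* con 1)) refl p) (<⇒≤ 256p<d)) ¬P1
  ... | suc q , Pq , ¬Pq+1 = suc q , s≤s z≤n , Pq , ≰⇒> ¬Pq+1

  m*m*d≤1024*r*r*p : ∀ m r p d q → 1 ≤ q → d < 256 * p * (suc q * suc q) → q * m < r → m * m * d ≤ 1024 * (r * r * p)
  m*m*d≤1024*r*r*p m r p d q 1≤q d<256p[q+1]² qm<r = begin
    m * m * d                                  ≤⟨ *-monoʳ-≤ (m * m) (<⇒≤ d<256p[q+1]²) ⟩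
    m * m * (256 * p * (suc q * suc q))        ≤⟨ *-monoʳ-≤ (m * m) (*-monoʳ-≤ (256 * p) (*-mono-≤ q+1≤2q q+1≤2q)) ⟩
    m * m * (256 * p * ((q + q) * (q + q)))    ≡⟨ solve 3 (λ m p q → m :* m :* (con 256 :* p :* ((q :+ q) :* (q :+ q)))
                                                                 := con 1024 :* ((q :* m) :* (q :* m) :* p)) refl m p q ⟩
    1024 * ((q * m) * (q * m) * p)             ≤⟨ *-monoʳ-≤ 1024 (*-monoˡ-≤ p (*-mono-≤ (<⇒≤ qm<r) (<⇒≤ qm<r))) ⟩
    1024 * (r * r * p)                         ∎
    where
    open ≤-Reasoning
    q+1≤2q : suc q ≤ q + q
    q+1≤2q = subst (_≤ q + q) (+-comm q 1) (+-monoʳ-≤ q 1≤q)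

open Combinatorics

open import Data.Nat using (ℕ; zero; suc)
open import Data.Fin.Subset using (Subset; ⊤)
open import Data.Product using (∃-syntax; _×_; _,_)
open import Data.Rational using (ℚ; 0ℚ; _<_; _≤_; _*_)
import Data.Nat as N
import Data.Nat.Properties as N
open import Data.Nat.Combinatorics using (_C_)
open import Data.Nat.Coprimality using (Coprime; 1-coprimeTo) renaming (sym to coprime-sym)
open import Data.Integer using (+_; -[1+_])
import Data.Integer as ℤ
import Data.Integer.Properties as ℤ
open import Data.Rational using (mkℚ; 1ℚ; _+_; _-_; -_; _/_; *≤*; *<*; toℚᵘ; Positive; positive; nonNegative)
import Data.Rational.Properties as ℚ
import Data.Rational.Unnormalised as ℚᵘ
import Data.Rational.Unnormalised.Properties as ℚᵘ
open import Data.Rational.Solver using (module +-*-Solver)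
open +-*-Solver using (solve; _:=_; con; _:+_; _:*_; _:-_)
open import Data.Unit using (tt)
open import Function using (_∘_)
open import Relation.Nullary using (contradiction; yes; no)
open import Relation.Nullary.Decidable using (toWitness)
open import Relation.Binary.PropositionalEquality

ℕtoℚ≡mkℚ : ∀ k → ℕtoℚ k ≡ mkℚ (+ k) 0 (coprime-sym (1-coprimeTo k))
ℕtoℚ≡mkℚ k = ℚ.normalize-coprime (coprime-sym (1-coprimeTo k))

ℕtoℚ-* : ∀ a b → ℕtoℚ (a N.* b) ≡ ℕtoℚ a * ℕtoℚ b
ℕtoℚ-* a b = trans (cong (_/ 1) (ℤ.pos-* a b)) (sym (cong₂ _*_ (ℕtoℚ≡mkℚ a) (ℕtoℚ≡mkℚ b)))

ℕtoℚ-+ : ∀ a b → ℕtoℚ (a N.+ b) ≡ ℕtoℚ a + ℕtoℚ b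
ℕtoℚ-+ a b = trans (cong (_/ 1) (trans (ℤ.pos-+ a b) (sym (cong₂ ℤ._+_ (ℤ.*-identityʳ (+ a)) (ℤ.*-identityʳ (+ b))))))
                   (sym (cong₂ _+_ (ℕtoℚ≡mkℚ a) (ℕtoℚ≡mkℚ b)))

ℕtoℚ-mono-≤ : ∀ {a b} → a N.≤ b → ℕtoℚ a ≤ ℕtoℚ b
ℕtoℚ-mono-≤ {a} {b} a≤b = subst₂ _≤_ (sym (ℕtoℚ≡mkℚ a)) (sym (ℕtoℚ≡mkℚ b))
  (*≤* (subst₂ ℤ._≤_ (sym (ℤ.*-identityʳ (+ a))) (sym (ℤ.*-identityʳ (+ b))) (ℤ.+≤+ a≤b)))

ℕtoℚ-mono-< : ∀ {a b} → a N.< b → ℕtoℚ a < ℕtoℚ b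
ℕtoℚ-mono-< {a} {b} a<b = subst₂ _<_ (sym (ℕtoℚ≡mkℚ a)) (sym (ℕtoℚ≡mkℚ b))
  (*<* (subst₂ ℤ._<_ (sym (ℤ.*-identityʳ (+ a))) (sym (ℤ.*-identityʳ (+ b))) (ℤ.+<+ a<b)))

mkℚ*denominator : ∀ p d-1 .(cp : Coprime p (suc d-1)) → mkℚ (+ p) d-1 cp * ℕtoℚ (suc d-1) ≡ ℕtoℚ p
mkℚ*denominator p d-1 cp = ℚ.toℚᵘ-injective (ℚᵘ.≃-trans (ℚ.toℚᵘ-homo-* (mkℚ (+ p) d-1 cp) (ℕtoℚ d)) unnormalised)
  where
  d = suc d-1
  unnormalised : toℚᵘ (mkℚ (+ p) d-1 cp) ℚᵘ.* toℚᵘ (ℕtoℚ d) ℚᵘ.≃ toℚᵘ (ℕtoℚ p)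
  unnormalised rewrite ℕtoℚ≡mkℚ d | ℕtoℚ≡mkℚ p =
    ℚᵘ.*≡* (trans (ℤ.*-identityʳ (+ p ℤ.* + d)) (cong (λ k → + p ℤ.* + k) (sym (N.*-identityʳ d))))

pos-*-< : ∀ a b c e → + a ℤ.* + b ℤ.< + c ℤ.* + e → a N.* b N.< c N.* e
pos-*-< a b c e = ℤ.drop‿+<+ ∘ subst₂ ℤ._<_ (sym (ℤ.pos-* a b)) (sym (ℤ.pos-* c e))

c : ℚ
c = + 1 / 32

ε₀ : ℚ
ε₀ = + 1 / 256

c-pos : 0ℚ < c
c-pos = toWitness {a? = 0ℚ ℚ.<? c} tt

ε₀-pos : 0ℚ < ε₀
ε₀-pos = toWitness {a? = 0ℚ ℚ.<? ε₀} tt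

ε-fraction : ∀ {ε} → 0ℚ < ε → ε < ε₀ → ∃[ p ] ∃[ d ] (1 N.≤ p × p N.* 256 N.< d × ε * ℕtoℚ d ≡ ℕtoℚ p)
ε-fraction {mkℚ -[1+ _ ] _ _} 0<ε _ = contradiction 0<ε (ℚ.<-asym (ℚ.negative⁻¹ _))
ε-fraction {mkℚ (+ p) d-1 cp} 0<ε ε<ε₀ =
  p , suc d-1 ,
  subst (0 N.<_) (N.*-identityʳ p) (pos-*-< 0 (suc d-1) p 1 (ℚ.drop-*<* 0<ε)) ,
  subst (p N.* 256 N.<_) (N.+-identityʳ (suc d-1)) (pos-*-< p 256 1 (suc d-1) (ℚ.drop-*<* ε<ε₀)) ,
  mkℚ*denominator p d-1 cp

c²m²≤r²ε : ∀ (m r p d : ℕ) ε → 0 N.< d → ε * ℕtoℚ d ≡ ℕtoℚ p →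
  m N.* m N.* d N.≤ 1024 N.* (r N.* r N.* p) → c * c * (ℕtoℚ m * ℕtoℚ m) ≤ ℕtoℚ r * ℕtoℚ r * ε
c²m²≤r²ε m r p d ε d>0 ε*d≡p h = ℚ.*-cancelʳ-≤-pos (ℕtoℚ (1024 N.* d)) {{1024d-pos}} (begin
  c * c * (M * M) * ℕtoℚ (1024 N.* d)    ≡⟨ cong (c * c * (M * M) *_) (ℕtoℚ-* 1024 d) ⟩
  c * c * (M * M) * (ℕtoℚ 1024 * D)      ≡⟨ solve 4 (λ c m k d → c :* c :* (m :* m) :* (k :* d) := (c :* c :* k) :* (m :* m :* d))
                                                    refl c M (ℕtoℚ 1024) D ⟩
  c * c * ℕtoℚ 1024 * (M * M * D)        ≡⟨⟩
  1ℚ * (M * M * D)                       ≡⟨ ℚ.*-identityˡ _ ⟩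
  M * M * D                              ≡⟨ trans (cong (_* D) (sym (ℕtoℚ-* m m))) (sym (ℕtoℚ-* (m N.* m) d)) ⟩
  ℕtoℚ (m N.* m N.* d)                   ≤⟨ ℕtoℚ-mono-≤ h ⟩
  ℕtoℚ (1024 N.* (r N.* r N.* p))        ≡⟨ trans (ℕtoℚ-* 1024 (r N.* r N.* p)) (cong (ℕtoℚ 1024 *_) r²p) ⟩
  ℕtoℚ 1024 * (R * R * ℕtoℚ p)           ≡⟨ cong (λ x → ℕtoℚ 1024 * (R * R * x)) ε*d≡p ⟨
  ℕtoℚ 1024 * (R * R * (ε * D))          ≡⟨ solve 4 (λ k r e d → k :* (r :* r :* (e :* d)) := r :* r :* e :* (k :* d))
                                                    refl (ℕtoℚ 1024) R ε D ⟩
  R * R * ε * (ℕtoℚ 1024 * D)            ≡⟨ cong (R * R * ε *_) (ℕtoℚ-* 1024 d) ⟨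
  R * R * ε * ℕtoℚ (1024 N.* d)          ∎)
  where
  open ℚ.≤-Reasoning
  M = ℕtoℚ m
  R = ℕtoℚ r
  D = ℕtoℚ d
  1024d-pos : Positive (ℕtoℚ (1024 N.* d))
  1024d-pos = positive (ℕtoℚ-mono-< (N.*-monoʳ-< 1024 d>0))
  r²p : ℕtoℚ (r N.* r N.* p) ≡ R * R * ℕtoℚ p
  r²p = trans (ℕtoℚ-* (r N.* r) p) (cong (_* ℕtoℚ p) (ℕtoℚ-* r r))

<1-ε : ∀ (s t p d : ℕ) ε → ε * ℕtoℚ d ≡ ℕtoℚ p → s N.* d N.+ p N.* t N.< d N.* t → ℕtoℚ s < (1ℚ - ε) * ℕtoℚ t
<1-ε s t p d ε ε*d≡p h = ℚ.*-cancelʳ-<-nonNeg D {{nonNegative (ℕtoℚ-mono-≤ {0} {d} N.z≤n)}} (begin-strict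
  S * D                          ≡⟨ solve 2 (λ x y → x := (x :+ y) :- y) refl (S * D) (P * T) ⟩
  (S * D + P * T) - P * T        ≡⟨ cong (_- P * T) (trans (ℕtoℚ-+ (s N.* d) (p N.* t)) (cong₂ _+_ (ℕtoℚ-* s d) (ℕtoℚ-* p t))) ⟨
  ℕtoℚ (s N.* d N.+ p N.* t) - P * T
                                 <⟨ ℚ.+-monoˡ-< (- (P * T)) (ℕtoℚ-mono-< h) ⟩
  ℕtoℚ (d N.* t) - P * T         ≡⟨ cong₂ (λ x y → x - y * T) (sym (ℕtoℚ-* d t)) ε*d≡p ⟨
  D * T - (ε * D) * T            ≡⟨ solve 3 (λ e d t → d :* t :- (e :* d) :* t := (con 1ℚ :- e) :* t :* d) refl ε D T ⟩
  (1ℚ - ε) * T * D               ∎)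
  where
  open ℚ.≤-Reasoning
  S = ℕtoℚ s
  D = ℕtoℚ d
  P = ℕtoℚ p
  T = ℕtoℚ t

HardDataSet : ℕ → ℚ → Set
HardDataSet m ε = ∃[ n ] ∃[ D ] (∀ (r : ℕ) → r N.≤ n →
  (∀ (A : Subset m) → Bad ε D A → RejectsWHP {n} {m} D A r) → c * c * (ℕtoℚ m * ℕtoℚ m) ≤ ℕtoℚ r * ℕtoℚ r * ε)

hardDataSet : ∀ m p d q ε → ε * ℕtoℚ d ≡ ℕtoℚ p → 0 N.< d → 1 N.≤ q →
  256 N.* p N.* (q N.* q) N.≤ d → d N.< 256 N.* p N.* (suc q N.* suc q) → HardDataSet m ε
hardDataSet zero    p d q ε ε*d≡p d>0 1≤q lower upper = 0 , (λ ()) , λ { _ N.z≤n _ → c²m²≤r²ε 0 0 p d ε d>0 ε*d≡p N.z≤n }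
hardDataSet (suc m) p d q ε ε*d≡p d>0 1≤q lower upper = L N.+ M , D , λ r _ rejecting → bound r (rejecting ⊤ bad)
  where
  L = suc m N.+ 2
  M = 8 N.* q N.* L
  D = cluster L M (suc m)
  bad : Bad ε D ⊤
  bad = <1-ε (numSeparated D ⊤) ((L N.+ M) C 2) p d ε ε*d≡p
             (cluster-fewSeparated p d q L (suc m) ⊤ 1≤q (N.m≤n+m 2 (suc m)) d>0 lower)
  bound : ∀ r → RejectsWHP D ⊤ r → c * c * (ℕtoℚ (suc m) * ℕtoℚ (suc m)) ≤ ℕtoℚ r * ℕtoℚ r * ε
  bound r rejecting with r N.≤? q N.* suc m
  ... | yes r≤qm = contradiction rejecting (cluster-¬rejectsWHP q m L r 1≤q (N.m≤m+n (suc m) 2) r≤qm)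
  ... | no  r≰qm = c²m²≤r²ε (suc m) r p d ε d>0 ε*d≡p (m*m*d≤1024*r*r*p (suc m) r p d q 1≤q upper (N.≰⇒> r≰qm))

lemma4 : ∃[ c ] ∃[ ε₀ ] (0ℚ < c × 0ℚ < ε₀ ×
           (∀ (m : ℕ) (ε : ℚ) → 0ℚ < ε → ε < ε₀ →
             ∃[ n ] ∃[ D ] (∀ (r : ℕ) → r N.≤ n →
               (∀ (A : Subset m) → Bad ε D A → RejectsWHP {n} {m} D A r) →
               c * c * (ℕtoℚ m * ℕtoℚ m) ≤ ℕtoℚ r * ℕtoℚ r * ε)))
lemma4 = c , ε₀ , c-pos , ε₀-pos , hard
  where
  hard : ∀ m ε → 0ℚ < ε → ε < ε₀ → HardDataSet m ε
  hard m ε 0<ε ε<ε₀ with ε-fraction 0<ε ε<ε₀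
  ... | p , d , 1≤p , 256p<d , ε*d≡p with scale p d 1≤p 256p<d
  ...   | q , 1≤q , lower , upper = hardDataSet m p d q ε ε*d≡p (N.≤-trans N.z<s 256p<d) 1≤q lower upper
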